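{- Let $c\in\{0,1\}^n$ and let $S_c\subseteq\{0,1\}^n$ be the set of all points at Hamming distance exactly $1$ from $c$. Let $A\subseteq S_c$ with $|A|=\ell\ge 3$, and let $c_A=\frac1{|A|}\sum_{x\in A}x\in\mathbb R^n$ be its centroid. Then (a) $d(c_A,a)<1$ for every $a\in A$, and (b) $d(c_A,a)\ge 1$ for every $a\in\{0,1\}^n\setminus(A\cup\{c\})$, where $d$ is the Euclidean distance. -}

module Defs where

open import Data.Bool using (Bool; true; false)
open import Data.Nat using (ℕ; zero; suc)
open import Data.Integer using (+_)
open import Data.Rational using (ℚ; 0ℚ; 1ℚ; _+_; _*_; _-_; _/_)
open import Data.List using (List; []; _∷_; length)
open import Data.Vec using (Vec; []; _∷_; map; zipWith; replicate; foldr)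

Point : ℕ → Set
Point n = Vec Bool n

hamming : ∀ {n} → Point n → Point n → ℕ
hamming [] [] = 0
hamming (true ∷ xs) (false ∷ ys) = suc (hamming xs ys)
hamming (false ∷ xs) (true ∷ ys) = suc (hamming xs ys)
hamming (true ∷ xs) (true ∷ ys) = hamming xs ys
hamming (false ∷ xs) (false ∷ ys) = hamming xs ys

bitℚ : Bool → ℚ
bitℚ true = 1ℚ
bitℚ false = 0ℚ

embed : ∀ {n} → Point n → Vec ℚ n
embed = map bitℚ

vsum : ∀ {n} → List (Point n) → Vec ℚ n
vsum {n} [] = replicate n 0ℚ
vsum (x ∷ xs) = zipWith _+_ (embed x) (vsum xs)

-- Centroid (1/|A|) Σ_{x∈A} x.  (For the empty list, which never occurs
-- under the hypotheses, it is the zero vector.)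
centroid : ∀ {n} → List (Point n) → Vec ℚ n
centroid {n} [] = replicate n 0ℚ
centroid (x ∷ xs) = map (λ q → q * ((+ 1) / suc (length xs))) (vsum (x ∷ xs))

dist² : ∀ {n} → Vec ℚ n → Vec ℚ n → ℚ
dist² u v = foldr _ _+_ 0ℚ (zipWith (λ a b → (a - b) * (a - b)) u v)

module Submission where

-- Each
-- point of A flips exactly one coordinate of c, and distinct points flip
-- distinct coordinates, so the spread s of A (in each coordinate, the number
-- of points of A differing from c there) is a 0/1 vector of weight ℓ.  After
-- reflecting the coordinates in which c is 1, the centroid c_A becomes s/ℓ,
-- and for a vertex a at distance k from c whose flipped coordinates meet those
-- of A in t places one finds
--     ℓ·d²(c_A, a) + 2t = 1 + kℓ.
-- For a ∈ A we have k = 1 ≤ t, so d² ≤ 1 − 1/ℓ < 1.  For a ∉ A ∪ {c} we have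
-- k ≥ 1, t ≤ min(k, ℓ) and t = 0 when k = 1, whence 2t + ℓ ≤ 1 + kℓ (using
-- ℓ ≥ 3 when k = 2), that is d² ≥ 1.

open import Defs
open import Data.Nat using (ℕ; _≤_)
open import Data.Rational using (ℚ; 1ℚ) renaming (_<_ to _<ℚ_; _≤_ to _≤ℚ_)
open import Data.List using (List; length)
open import Data.List.Relation.Unary.All using (All)
open import Data.List.Relation.Unary.Unique.Propositional using (Unique)
open import Data.List.Membership.Propositional using (_∈_; _∉_)
open import Data.Product using (_×_)
open import Relation.Binary.PropositionalEquality using (_≡_; _≢_)

module Flips where
  open import Data.Bool using (Bool; true; false)
  open import Data.Nat
  open import Data.Nat.Properties
  open import Data.List using ([]; _∷_)
  import Data.List.Relation.Unary.All as All
  open import Data.List.Relation.Unary.Any using (here; there)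
  open import Data.List.Relation.Unary.AllPairs using (_∷_)
  open import Data.Vec using (Vec; []; _∷_; zipWith; replicate; sum)
  import Data.Vec.Relation.Unary.All as VAll
  open import Algebra.Properties.CommutativeSemigroup +-commutativeSemigroup using (interchange)
  open import Data.Empty using (⊥-elim)
  open import Function using (_∘_)
  open import Relation.Binary.PropositionalEquality using (refl; sym; trans; cong; cong₂; subst; module ≡-Reasoning)

  differ : Bool → Bool → ℕ
  differ false false = 0
  differ false true  = 1
  differ true  false = 1
  differ true  true  = 0

  flips : ∀ {n} → Point n → Point n → Vec ℕ n
  flips = zipWith differ

  spread : ∀ {n} → Point n → List (Point n) → Vec ℕ n
  spread {n} c []       = replicate n 0
  spread     c (x ∷ xs) = zipWith _+_ (flips c x) (spread c xs)

  dot : ∀ {n} → Vec ℕ n → Vec ℕ n → ℕ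
  dot u v = sum (zipWith _*_ u v)

  shared : ∀ {n} → Point n → List (Point n) → Point n → ℕ
  shared c A a = dot (spread c A) (flips c a)

  Binary : ∀ {n} → Vec ℕ n → Set
  Binary = VAll.All (_≤ 1)

  Neighbours : ∀ {n} → Point n → List (Point n) → Set
  Neighbours c A = All (λ x → hamming c x ≡ 1) A

  sum-+ : ∀ {n} (u v : Vec ℕ n) → sum (zipWith _+_ u v) ≡ sum u + sum v
  sum-+ []      []      = refl
  sum-+ (a ∷ u) (b ∷ v) = trans (cong (a + b +_) (sum-+ u v)) (interchange a b (sum u) (sum v))

  sum-zeros : ∀ n → sum (replicate n 0) ≡ 0
  sum-zeros zero    = refl
  sum-zeros (suc n) = sum-zeros n

  dot-comm : ∀ {n} (u v : Vec ℕ n) → dot u v ≡ dot v u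
  dot-comm []      []      = refl
  dot-comm (a ∷ u) (b ∷ v) = cong₂ _+_ (*-comm a b) (dot-comm u v)

  dot-+ˡ : ∀ {n} (u v w : Vec ℕ n) → dot (zipWith _+_ u v) w ≡ dot u w + dot v w
  dot-+ˡ []      []      []      = refl
  dot-+ˡ (a ∷ u) (b ∷ v) (c ∷ w) = begin
    (a + b) * c + dot (zipWith _+_ u v) w  ≡⟨ cong₂ _+_ (*-distribʳ-+ c a b) (dot-+ˡ u v w) ⟩
    (a * c + b * c) + (dot u w + dot v w)  ≡⟨ interchange (a * c) (b * c) (dot u w) (dot v w) ⟩
    (a * c + dot u w) + (b * c + dot v w)  ∎
    where open ≡-Reasoning

  dot-zeroˡ : ∀ {n} (w : Vec ℕ n) → dot (replicate n 0) w ≡ 0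
  dot-zeroˡ []      = refl
  dot-zeroˡ (_ ∷ w) = dot-zeroˡ w

  dot-self : ∀ {n} {u : Vec ℕ n} → Binary u → dot u u ≡ sum u
  dot-self VAll.[]                = refl
  dot-self (z≤n     VAll.∷ bu) = dot-self bu
  dot-self (s≤s z≤n VAll.∷ bu) = cong suc (dot-self bu)

  dot≤sum : ∀ {n} {u : Vec ℕ n} → Binary u → (v : Vec ℕ n) → dot u v ≤ sum v
  dot≤sum VAll.[]          []      = z≤n
  dot≤sum (a≤1 VAll.∷ bu) (b ∷ v) =
    +-mono-≤ (≤-trans (*-monoˡ-≤ b a≤1) (≤-reflexive (*-identityˡ b))) (dot≤sum bu v)

  zeros-binary : ∀ n → Binary (replicate n 0)
  zeros-binary zero    = VAll.[]
  zeros-binary (suc n) = z≤n VAll.∷ zeros-binary n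

  binary-+ : ∀ {n} {u v : Vec ℕ n} → Binary u → Binary v → dot u v ≡ 0 → Binary (zipWith _+_ u v)
  binary-+ VAll.[] VAll.[] _ = VAll.[]
  binary-+ {u = a ∷ _} (a≤1 VAll.∷ bu) (b≤1 VAll.∷ bv) uv≡0 =
    entry a≤1 b≤1 (m+n≡0⇒m≡0 (a * _) uv≡0) VAll.∷ binary-+ bu bv (m+n≡0⇒n≡0 (a * _) uv≡0)
    where
    entry : ∀ {a b} → a ≤ 1 → b ≤ 1 → a * b ≡ 0 → a + b ≤ 1
    entry z≤n       b≤1       _  = b≤1
    entry (s≤s z≤n) z≤n       _  = s≤s z≤n
    entry (s≤s z≤n) (s≤s z≤n) ()

  hamming-∷ : ∀ {n} c₀ x₀ (c x : Point n) → hamming (c₀ ∷ c) (x₀ ∷ x) ≡ differ c₀ x₀ + hamming c x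
  hamming-∷ false false c x = refl
  hamming-∷ false true  c x = refl
  hamming-∷ true  false c x = refl
  hamming-∷ true  true  c x = refl

  sum-flips : ∀ {n} (c x : Point n) → sum (flips c x) ≡ hamming c x
  sum-flips []       []       = refl
  sum-flips (c₀ ∷ c) (x₀ ∷ x) = trans (cong (differ c₀ x₀ +_) (sum-flips c x)) (sym (hamming-∷ c₀ x₀ c x))

  flips-binary : ∀ {n} (c x : Point n) → Binary (flips c x)
  flips-binary []       []       = VAll.[]
  flips-binary (c₀ ∷ c) (x₀ ∷ x) = differ≤1 c₀ x₀ VAll.∷ flips-binary c x
    where
    differ≤1 : ∀ b b′ → differ b b′ ≤ 1
    differ≤1 false false = z≤n
    differ≤1 false true  = s≤s z≤n
    differ≤1 true  false = s≤s z≤n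
    differ≤1 true  true  = z≤n

  flips-self : ∀ {n} (c : Point n) → flips c c ≡ replicate n 0
  flips-self []          = refl
  flips-self (false ∷ c) = cong (0 ∷_) (flips-self c)
  flips-self (true  ∷ c) = cong (0 ∷_) (flips-self c)

  hamming-zero : ∀ {n} (c x : Point n) → hamming c x ≡ 0 → x ≡ c
  hamming-zero []          []          _ = refl
  hamming-zero (false ∷ c) (false ∷ x) e = cong (false ∷_) (hamming-zero c x e)
  hamming-zero (true  ∷ c) (true  ∷ x) e = cong (true ∷_) (hamming-zero c x e)

  -- A neighbour of c ∷ … that differs from it in the first coordinate agrees
  -- with c in all the others, and so is orthogonal to every flip vector.
  flipped-head : ∀ {n} (c x : Point n) → suc (hamming c x) ≡ 1 → x ≡ c
  flipped-head c x e = hamming-zero c x (suc-injective e)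

  dot-at-centreʳ : ∀ {n} (c x : Point n) {y} → y ≡ c → dot (flips c x) (flips c y) ≡ 0
  dot-at-centreʳ {n} c x refl = begin
    dot (flips c x) (flips c c)      ≡⟨ cong (dot (flips c x)) (flips-self c) ⟩
    dot (flips c x) (replicate n 0)  ≡⟨ dot-comm (flips c x) _ ⟩
    dot (replicate n 0) (flips c x)  ≡⟨ dot-zeroˡ (flips c x) ⟩
    0                                ∎
    where open ≡-Reasoning

  dot-at-centreˡ : ∀ {n} (c : Point n) {x} y → x ≡ c → dot (flips c x) (flips c y) ≡ 0
  dot-at-centreˡ c {x} y x≡c = trans (dot-comm (flips c x) (flips c y)) (dot-at-centreʳ c y x≡c)

  neighbours-disjoint : ∀ {n} (c x y : Point n) → hamming c x ≡ 1 → hamming c y ≡ 1 → x ≢ y →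
                        dot (flips c x) (flips c y) ≡ 0
  neighbours-disjoint [] [] [] () _ _
  neighbours-disjoint (false ∷ c) (false ∷ x) (false ∷ y) hx hy x≢y =
    neighbours-disjoint c x y hx hy (x≢y ∘ cong (false ∷_))
  neighbours-disjoint (true  ∷ c) (true  ∷ x) (true  ∷ y) hx hy x≢y =
    neighbours-disjoint c x y hx hy (x≢y ∘ cong (true ∷_))
  neighbours-disjoint (false ∷ c) (false ∷ x) (true  ∷ y) hx hy _ = dot-at-centreʳ c x (flipped-head c y hy)
  neighbours-disjoint (true  ∷ c) (true  ∷ x) (false ∷ y) hx hy _ = dot-at-centreʳ c x (flipped-head c y hy)
  neighbours-disjoint (false ∷ c) (true  ∷ x) (false ∷ y) hx hy _ = dot-at-centreˡ c y (flipped-head c x hx)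
  neighbours-disjoint (true  ∷ c) (false ∷ x) (true  ∷ y) hx hy _ = dot-at-centreˡ c y (flipped-head c x hx)
  neighbours-disjoint (false ∷ c) (true  ∷ x) (true  ∷ y) hx hy x≢y =
    ⊥-elim (x≢y (cong (true ∷_) (trans (flipped-head c x hx) (sym (flipped-head c y hy)))))
  neighbours-disjoint (true  ∷ c) (false ∷ x) (false ∷ y) hx hy x≢y =
    ⊥-elim (x≢y (cong (false ∷_) (trans (flipped-head c x hx) (sym (flipped-head c y hy)))))

  dot-spread-member : ∀ {n} (c : Point n) {a A} → a ∈ A → (w : Vec ℕ n) → dot (flips c a) w ≤ dot (spread c A) w
  dot-spread-member c {A = x ∷ xs} (here refl) w = begin
    dot (flips c x) w                        ≤⟨ m≤m+n _ _ ⟩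
    dot (flips c x) w + dot (spread c xs) w  ≡⟨ dot-+ˡ (flips c x) (spread c xs) w ⟨
    dot (spread c (x ∷ xs)) w                ∎
    where open ≤-Reasoning
  dot-spread-member c {a} {x ∷ xs} (there a∈xs) w = begin
    dot (flips c a) w                        ≤⟨ dot-spread-member c a∈xs w ⟩
    dot (spread c xs) w                      ≤⟨ m≤n+m _ _ ⟩
    dot (flips c x) w + dot (spread c xs) w  ≡⟨ dot-+ˡ (flips c x) (spread c xs) w ⟨
    dot (spread c (x ∷ xs)) w                ∎
    where open ≤-Reasoning

  dot-spread-zero : ∀ {n} (c : Point n) A (w : Vec ℕ n) →
                    (∀ {x} → x ∈ A → dot (flips c x) w ≡ 0) → dot (spread c A) w ≡ 0
  dot-spread-zero c []       w _    = dot-zeroˡ w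
  dot-spread-zero c (x ∷ xs) w orth = begin
    dot (spread c (x ∷ xs)) w                ≡⟨ dot-+ˡ (flips c x) (spread c xs) w ⟩
    dot (flips c x) w + dot (spread c xs) w  ≡⟨ cong₂ _+_ (orth (here refl)) (dot-spread-zero c xs w (orth ∘ there)) ⟩
    0                                        ∎
    where open ≡-Reasoning

  sum-spread : ∀ {n} (c : Point n) A → Neighbours c A → sum (spread c A) ≡ length A
  sum-spread {n} c []       _              = sum-zeros n
  sum-spread     c (x ∷ xs) (hx All.∷ hxs) = begin
    sum (zipWith _+_ (flips c x) (spread c xs))  ≡⟨ sum-+ (flips c x) (spread c xs) ⟩
    sum (flips c x) + sum (spread c xs)          ≡⟨ cong₂ _+_ (trans (sum-flips c x) hx) (sum-spread c xs hxs) ⟩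
    suc (length xs)                              ∎
    where open ≡-Reasoning

  spread-binary : ∀ {n} (c : Point n) A → Unique A → Neighbours c A → Binary (spread c A)
  spread-binary {n} c []       _            _              = zeros-binary n
  spread-binary     c (x ∷ xs) (x∉xs ∷ uxs) (hx All.∷ hxs) =
    binary-+ (flips-binary c x) (spread-binary c xs uxs hxs)
      (trans (dot-comm (flips c x) (spread c xs)) (dot-spread-zero c xs (flips c x) orth))
    where
    orth : ∀ {y} → y ∈ xs → dot (flips c y) (flips c x) ≡ 0
    orth y∈xs = neighbours-disjoint c _ x (All.lookup hxs y∈xs) hx (λ y≡x → All.lookup x∉xs y∈xs (sym y≡x))

  shared-member : ∀ {n} (c : Point n) {a A} → a ∈ A → hamming c a ≤ shared c A a
  shared-member c {a} {A} a∈A = begin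
    hamming c a                  ≡⟨ trans (dot-self (flips-binary c a)) (sum-flips c a) ⟨
    dot (flips c a) (flips c a)  ≤⟨ dot-spread-member c a∈A (flips c a) ⟩
    shared c A a                 ∎
    where open ≤-Reasoning

  shared≤hamming : ∀ {n} (c : Point n) A a → Unique A → Neighbours c A → shared c A a ≤ hamming c a
  shared≤hamming c A a uA hA = subst (shared c A a ≤_) (sum-flips c a) (dot≤sum (spread-binary c A uA hA) (flips c a))

  shared≤length : ∀ {n} (c : Point n) A a → Neighbours c A → shared c A a ≤ length A
  shared≤length c A a hA = begin
    shared c A a                  ≡⟨ dot-comm (spread c A) (flips c a) ⟩
    dot (flips c a) (spread c A)  ≤⟨ dot≤sum (flips-binary c a) (spread c A) ⟩
    sum (spread c A)              ≡⟨ sum-spread c A hA ⟩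
    length A                      ∎
    where open ≤-Reasoning

  shared-outsider : ∀ {n} (c : Point n) A a → Neighbours c A → hamming c a ≡ 1 → a ∉ A → shared c A a ≡ 0
  shared-outsider c A a hA ha a∉A = dot-spread-zero c A (flips c a) orth
    where
    orth : ∀ {y} → y ∈ A → dot (flips c y) (flips c a) ≡ 0
    orth y∈A = neighbours-disjoint c _ a (All.lookup hA y∈A) ha (λ y≡a → a∉A (subst (_∈ A) y≡a y∈A))

module Bounds where
  open import Data.Nat
  open import Data.Nat.Properties
  open import Data.Empty using (⊥-elim)
  open import Relation.Binary.PropositionalEquality using (refl; sym; cong)

  far-enough : ∀ ℓ k t → 3 ≤ ℓ → k ≢ 0 → t ≤ k → t ≤ ℓ → (k ≡ 1 → t ≡ 0) → 2 * t + ℓ ≤ 1 + k * ℓ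
  far-enough ℓ zero                t _   k≢0 _   _   _       = ⊥-elim (k≢0 refl)
  far-enough ℓ (suc zero)          t _   _   _   _   k≡1⇒t≡0 rewrite k≡1⇒t≡0 refl =
    m≤n⇒m≤1+n (m≤m+n ℓ 0)
  far-enough ℓ (suc (suc zero))    t 3≤ℓ _   t≤2 _   _       = begin
    2 * t + ℓ          ≤⟨ +-monoˡ-≤ ℓ (*-monoʳ-≤ 2 t≤2) ⟩
    4 + ℓ              ≤⟨ s≤s (+-monoˡ-≤ ℓ 3≤ℓ) ⟩
    1 + (ℓ + ℓ)        ≡⟨ cong (λ z → 1 + (ℓ + z)) (sym (+-identityʳ ℓ)) ⟩
    1 + 2 * ℓ          ∎
    where open ≤-Reasoning
  far-enough ℓ (suc (suc (suc k))) t _   _   _   t≤ℓ _       = begin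
    2 * t + ℓ          ≤⟨ +-monoˡ-≤ ℓ (*-monoʳ-≤ 2 t≤ℓ) ⟩
    2 * ℓ + ℓ          ≡⟨ +-comm (2 * ℓ) ℓ ⟩
    3 * ℓ              ≤⟨ *-monoˡ-≤ ℓ {3} {3 + k} (s≤s (s≤s (s≤s z≤n))) ⟩
    (3 + k) * ℓ        ≤⟨ n≤1+n _ ⟩
    1 + (3 + k) * ℓ    ∎
    where open ≤-Reasoning

  close-enough : ∀ ℓ t → 1 ≤ t → 1 + 1 * ℓ < 2 * t + ℓ
  close-enough ℓ t 1≤t = begin-strict
    1 + 1 * ℓ          ≡⟨ cong suc (+-identityʳ ℓ) ⟩
    1 + ℓ              <⟨ n<1+n (1 + ℓ) ⟩
    2 + ℓ              ≤⟨ +-monoˡ-≤ ℓ (*-monoʳ-≤ 2 1≤t) ⟩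
    2 * t + ℓ          ∎
    where open ≤-Reasoning

module Centroid where
  open Flips using (differ; flips; spread; dot; shared; Neighbours; hamming-∷; dot-self; spread-binary; sum-spread)
  open import Data.Bool using (Bool; true; false)
  import Data.Nat as Nat
  open Nat using (suc)
  open import Data.Integer using (+_)
  import Data.Integer as ℤ
  import Data.Integer.Properties as ℤ
  open import Data.Rational hiding (_≤_; _<_)
  open import Data.Rational.Literals using (fromℤ)
  open import Data.Rational.Properties
  import Data.Rational.Unnormalised as ℚᵘ
  import Data.Rational.Unnormalised.Properties as ℚᵘ
  open import Data.Rational.Solver using (module +-*-Solver)
  open +-*-Solver
  open import Data.Nat.Coprimality using (1-coprimeTo)
  open import Data.Vec using (Vec; []; _∷_; zipWith; map; replicate)
  open import Data.List using (List; []; _∷_; length)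
  open import Relation.Binary.PropositionalEquality using (refl; sym; trans; cong; cong₂; subst₂; module ≡-Reasoning)

  ι : ℕ → ℚ
  ι n = fromℤ (+ n)

  ι-+ : ∀ m n → ι (m Nat.+ n) ≡ ι m + ι n
  ι-+ m n = toℚᵘ-injective (ℚᵘ.≃-trans (ℚᵘ.*≡* eq) (ℚᵘ.≃-sym (toℚᵘ-homo-+ (ι m) (ι n))))
    where
    eq : + (m Nat.+ n) ℤ.* + 1 ≡ (+ m ℤ.* + 1 ℤ.+ + n ℤ.* + 1) ℤ.* + 1
    eq rewrite ℤ.*-identityʳ (+ m) | ℤ.*-identityʳ (+ n) = cong (ℤ._* + 1) (ℤ.pos-+ m n)

  ι-* : ∀ m n → ι (m Nat.* n) ≡ ι m * ι n
  ι-* m n = toℚᵘ-injective (ℚᵘ.≃-trans (ℚᵘ.*≡* eq) (ℚᵘ.≃-sym (toℚᵘ-homo-* (ι m) (ι n))))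
    where
    eq : + (m Nat.* n) ℤ.* + 1 ≡ (+ m ℤ.* + n) ℤ.* + 1
    eq = cong (ℤ._* + 1) (ℤ.pos-* m n)

  ι-*+ : ∀ a b c → ι (a Nat.* b Nat.+ c) ≡ ι a * ι b + ι c
  ι-*+ a b c = trans (ι-+ (a Nat.* b) c) (cong (_+ ι c) (ι-* a b))

  ι-mono-≤ : ∀ {m n} → m Nat.≤ n → ι m ≤ℚ ι n
  ι-mono-≤ {m} {n} m≤n = *≤* (subst₂ ℤ._≤_ (sym (ℤ.*-identityʳ (+ m))) (sym (ℤ.*-identityʳ (+ n))) (ℤ.+≤+ m≤n))

  ι-mono-< : ∀ {m n} → m Nat.< n → ι m <ℚ ι n
  ι-mono-< {m} {n} m<n = *<* (subst₂ ℤ._<_ (sym (ℤ.*-identityʳ (+ m))) (sym (ℤ.*-identityʳ (+ n))) (ℤ.+<+ m<n))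

  ι-inverse : ∀ m → ι (suc m) * (+ 1 / suc m) ≡ 1ℚ
  ι-inverse m = trans (cong (ι (suc m) *_) (normalize-coprime (1-coprimeTo (suc m)))) (*-inverseʳ (ι (suc m)))

  two : ℚ
  two = 1ℚ + 1ℚ

  -- ones L c₀ S is the number of points having a 1 in a coordinate where c has
  -- bit c₀, when L points are considered and S of them differ from c there.
  ones : ℚ → Bool → ℚ → ℚ
  ones L false S = S
  ones L true  S = L - S

  ones-step : ∀ ℓ c₀ x₀ s → bitℚ x₀ + ones (ι ℓ) c₀ (ι s) ≡ ones (ι (suc ℓ)) c₀ (ι (differ c₀ x₀ Nat.+ s))
  ones-step ℓ false false s = +-identityˡ (ι s)
  ones-step ℓ false true  s = sym (ι-+ 1 s)
  ones-step ℓ true  true  s = trans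
    (solve 2 (λ L S → con 1ℚ :+ (L :- S) := (con 1ℚ :+ L) :- S) refl (ι ℓ) (ι s))
    (cong (_- ι s) (sym (ι-+ 1 ℓ)))
  ones-step ℓ true  false s = trans
    (solve 2 (λ L S → con 0ℚ :+ (L :- S) := (con 1ℚ :+ L) :- (con 1ℚ :+ S)) refl (ι ℓ) (ι s))
    (sym (cong₂ _-_ (ι-+ 1 ℓ) (ι-+ 1 s)))

  vsum-spread : ∀ {n} (c : Point n) A → vsum A ≡ zipWith (ones (ι (length A))) c (map ι (spread c A))
  vsum-spread c []       = empty c
    where
    empty : ∀ {m} (c : Point m) → replicate m 0ℚ ≡ zipWith (ones (ι 0)) c (map ι (replicate m 0))
    empty []          = refl
    empty (false ∷ c) = cong (0ℚ ∷_) (empty c)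
    empty (true  ∷ c) = cong (0ℚ ∷_) (empty c)
  vsum-spread c (x ∷ xs) = trans (cong (zipWith _+_ (embed x)) (vsum-spread c xs)) (add-point c x (spread c xs))
    where
    add-point : ∀ {m} (c x : Point m) (s : Vec ℕ m) →
                zipWith _+_ (embed x) (zipWith (ones (ι (length xs))) c (map ι s))
                ≡ zipWith (ones (ι (suc (length xs)))) c (map ι (zipWith Nat._+_ (flips c x) s))
    add-point []       []       []       = refl
    add-point (c₀ ∷ c) (x₀ ∷ x) (s₀ ∷ s) = cong₂ _∷_ (ones-step (length xs) c₀ x₀ s₀) (add-point c x s)

  -- Reflecting the coordinates where c is 1: when L·q = 1, the deviation of a
  -- rescaled coordinate ones L c₀ S · q from a₀ is ±(S·q − d), d = [a₀ ≠ c₀].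
  deviation : ∀ L q S c₀ a₀ → L * q ≡ 1ℚ →
              let δ = ones L c₀ S * q - bitℚ a₀ ; d = ι (differ c₀ a₀) in
              δ * δ ≡ (S * q - d) * (S * q - d)
  deviation L q S false false _    = refl
  deviation L q S false true  _    = refl
  deviation L q S true  true  Lq≡1 = begin
    ((L - S) * q - 1ℚ) * ((L - S) * q - 1ℚ)
      ≡⟨ solve 3 (λ L q S → ((L :- S) :* q :- con 1ℚ) :* ((L :- S) :* q :- con 1ℚ)
                        := (L :* q :- S :* q :- con 1ℚ) :* (L :* q :- S :* q :- con 1ℚ)) refl L q S ⟩
    (L * q - S * q - 1ℚ) * (L * q - S * q - 1ℚ)
      ≡⟨ cong (λ u → (u - S * q - 1ℚ) * (u - S * q - 1ℚ)) Lq≡1 ⟩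
    (1ℚ - S * q - 1ℚ) * (1ℚ - S * q - 1ℚ)
      ≡⟨ solve 2 (λ q S → (con 1ℚ :- S :* q :- con 1ℚ) :* (con 1ℚ :- S :* q :- con 1ℚ)
                      := (S :* q :- con 0ℚ) :* (S :* q :- con 0ℚ)) refl q S ⟩
    (S * q - 0ℚ) * (S * q - 0ℚ) ∎
    where open ≡-Reasoning
  deviation L q S true  false Lq≡1 = begin
    ((L - S) * q - 0ℚ) * ((L - S) * q - 0ℚ)
      ≡⟨ solve 3 (λ L q S → ((L :- S) :* q :- con 0ℚ) :* ((L :- S) :* q :- con 0ℚ)
                        := (L :* q :- S :* q) :* (L :* q :- S :* q)) refl L q S ⟩
    (L * q - S * q) * (L * q - S * q)
      ≡⟨ cong (λ u → (u - S * q) * (u - S * q)) Lq≡1 ⟩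
    (1ℚ - S * q) * (1ℚ - S * q)
      ≡⟨ solve 2 (λ q S → (con 1ℚ :- S :* q) :* (con 1ℚ :- S :* q)
                      := (S :* q :- con 1ℚ) :* (S :* q :- con 1ℚ)) refl q S ⟩
    (S * q - 1ℚ) * (S * q - 1ℚ) ∎
    where open ≡-Reasoning

  square-identity : ∀ L q S d → L * q ≡ 1ℚ → d * d ≡ d →
                    L * ((S * q - d) * (S * q - d)) + two * (S * d) ≡ S * S * q + d * L
  square-identity L q S d Lq≡1 dd≡d = begin
    L * ((S * q - d) * (S * q - d)) + two * (S * d)
      ≡⟨ solve 4 (λ L q S d → L :* ((S :* q :- d) :* (S :* q :- d)) :+ con two :* (S :* d)
                          := S :* S :* q :* (L :* q) :- con two :* (S :* d) :* (L :* q)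
                             :+ (d :* d) :* L :+ con two :* (S :* d)) refl L q S d ⟩
    S * S * q * (L * q) - two * (S * d) * (L * q) + (d * d) * L + two * (S * d)
      ≡⟨ cong₂ (λ u v → S * S * q * u - two * (S * d) * u + v * L + two * (S * d)) Lq≡1 dd≡d ⟩
    S * S * q * 1ℚ - two * (S * d) * 1ℚ + d * L + two * (S * d)
      ≡⟨ solve 4 (λ L q S d → S :* S :* q :* con 1ℚ :- con two :* (S :* d) :* con 1ℚ :+ d :* L :+ con two :* (S :* d)
                          := S :* S :* q :+ d :* L) refl L q S d ⟩
    S * S * q + d * L ∎
    where open ≡-Reasoning

  differ-idempotent : ∀ c₀ a₀ → ι (differ c₀ a₀) * ι (differ c₀ a₀) ≡ ι (differ c₀ a₀)
  differ-idempotent false false = refl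
  differ-idempotent false true  = refl
  differ-idempotent true  false = refl
  differ-idempotent true  true  = refl

  scaled-dist² : ∀ {n} ℓ q (c a : Point n) (s : Vec ℕ n) → ι ℓ * q ≡ 1ℚ →
                 ι ℓ * dist² (map (_* q) (zipWith (ones (ι ℓ)) c (map ι s))) (embed a) + two * ι (dot s (flips c a))
                 ≡ ι (dot s s) * q + ι (hamming c a) * ι ℓ
  scaled-dist² ℓ q [] [] [] _ =
    solve 2 (λ L q → L :* con 0ℚ :+ con two :* con 0ℚ := con 0ℚ :* q :+ con 0ℚ :* L) refl (ι ℓ) q
  scaled-dist² ℓ q (c₀ ∷ c) (a₀ ∷ a) (s₀ ∷ s) Lq≡1 = begin
    L * (δ * δ + F) + two * ι (s₀ Nat.* e Nat.+ dot s (flips c a))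
      ≡⟨ cong (λ t → L * (δ * δ + F) + two * t) (ι-*+ s₀ e _) ⟩
    L * (δ * δ + F) + two * (S * d + T)
      ≡⟨ solve 5 (λ L δ F Sd T → L :* (δ :* δ :+ F) :+ con two :* (Sd :+ T)
                             := (L :* (δ :* δ) :+ con two :* Sd) :+ (L :* F :+ con two :* T)) refl L δ F (S * d) T ⟩
    (L * (δ * δ) + two * (S * d)) + (L * F + two * T)
      ≡⟨ cong (λ u → (L * u + two * (S * d)) + (L * F + two * T)) (deviation L q S c₀ a₀ Lq≡1) ⟩
    (L * ((S * q - d) * (S * q - d)) + two * (S * d)) + (L * F + two * T)
      ≡⟨ cong₂ _+_ (square-identity L q S d Lq≡1 (differ-idempotent c₀ a₀)) (scaled-dist² ℓ q c a s Lq≡1) ⟩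
    (S * S * q + d * L) + (P * q + K * L)
      ≡⟨ solve 6 (λ L q S d P K → (S :* S :* q :+ d :* L) :+ (P :* q :+ K :* L)
                              := (S :* S :+ P) :* q :+ (d :+ K) :* L) refl L q S d P K ⟩
    (S * S + P) * q + (d + K) * L
      ≡⟨ cong₂ (λ u v → u * q + v * L) (ι-*+ s₀ s₀ _) (trans (cong ι (hamming-∷ c₀ a₀ c a)) (ι-+ e _)) ⟨
    ι (s₀ Nat.* s₀ Nat.+ dot s s) * q + ι (hamming (c₀ ∷ c) (a₀ ∷ a)) * L ∎
    where
    open ≡-Reasoning
    e : ℕ
    L S d δ F T P K : ℚ
    L = ι ℓ
    S = ι s₀
    e = differ c₀ a₀
    d = ι e
    δ = ones L c₀ S * q - bitℚ a₀
    F = dist² (map (_* q) (zipWith (ones L) c (map ι s))) (embed a)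
    T = ι (dot s (flips c a))
    P = ι (dot s s)
    K = ι (hamming c a)

  centroid-identity : ∀ {n} (c x : Point n) xs → Unique (x ∷ xs) → Neighbours c (x ∷ xs) → (a : Point n) →
                      ι (suc (length xs)) * dist² (centroid (x ∷ xs)) (embed a) + two * ι (shared c (x ∷ xs) a)
                      ≡ 1ℚ + ι (hamming c a) * ι (suc (length xs))
  centroid-identity {n} c x xs uA hA a = begin
    L * dist² (centroid A) (embed a) + two * t
      ≡⟨ cong (λ y → L * dist² (map (_* q) y) (embed a) + two * t) (vsum-spread c A) ⟩
    L * dist² (map (_* q) (zipWith (ones L) c (map ι s))) (embed a) + two * t
      ≡⟨ scaled-dist² ℓ q c a s (ι-inverse (length xs)) ⟩
    ι (dot s s) * q + K * L
      ≡⟨ cong (λ u → ι u * q + K * L) (trans (dot-self (spread-binary c A uA hA)) (sum-spread c A hA)) ⟩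
    L * q + K * L
      ≡⟨ cong (_+ K * L) (ι-inverse (length xs)) ⟩
    1ℚ + K * L ∎
    where
    open ≡-Reasoning
    A : List (Point n)
    ℓ : ℕ
    L q t K : ℚ
    s : Vec ℕ n
    A = x ∷ xs
    ℓ = suc (length xs)
    L = ι ℓ
    q = + 1 / ℓ
    s = spread c A
    t = ι (shared c A a)
    K = ι (hamming c a)

  +-cancel : ∀ x r → x + r - r ≡ x
  +-cancel = solve 2 (λ x r → x :+ r :- r := x) refl

  +-cancelʳ-≤ : ∀ p q r → p + r ≤ℚ q + r → p ≤ℚ q
  +-cancelʳ-≤ p q r p+r≤q+r = subst₂ _≤ℚ_ (+-cancel p r) (+-cancel q r) (+-monoˡ-≤ (- r) p+r≤q+r)

  +-cancelʳ-< : ∀ p q r → p + r <ℚ q + r → p <ℚ q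
  +-cancelʳ-< p q r p+r<q+r = subst₂ _<ℚ_ (+-cancel p r) (+-cancel q r) (+-monoˡ-< (- r) p+r<q+r)

  ι-2t+ℓ : ∀ t ℓ → ι (2 Nat.* t Nat.+ ℓ) ≡ two * ι t + ι ℓ
  ι-2t+ℓ t ℓ = ι-*+ 2 t ℓ

  ι-1+kℓ : ∀ k ℓ → ι (1 Nat.+ k Nat.* ℓ) ≡ 1ℚ + ι k * ι ℓ
  ι-1+kℓ k ℓ = trans (ι-+ 1 (k Nat.* ℓ)) (cong (λ x → 1ℚ + x) (ι-* k ℓ))

  L*1+2t : ∀ L T → L * 1ℚ + two * T ≡ two * T + L
  L*1+2t = solve 2 (λ L T → L :* con 1ℚ :+ con two :* T := con two :* T :+ L) refl

  at-least-one : ∀ m t k D → ι (suc m) * D + two * ι t ≡ 1ℚ + ι k * ι (suc m) →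
                 2 Nat.* t Nat.+ suc m Nat.≤ 1 Nat.+ k Nat.* suc m → 1ℚ ≤ℚ D
  at-least-one m t k D identity 2t+ℓ≤1+kℓ =
    *-cancelˡ-≤-pos L (+-cancelʳ-≤ (L * 1ℚ) (L * D) (two * ι t) (begin
      L * 1ℚ + two * ι t         ≡⟨ L*1+2t L (ι t) ⟩
      two * ι t + L              ≡⟨ ι-2t+ℓ t (suc m) ⟨
      ι (2 Nat.* t Nat.+ suc m)  ≤⟨ ι-mono-≤ 2t+ℓ≤1+kℓ ⟩
      ι (1 Nat.+ k Nat.* suc m)  ≡⟨ ι-1+kℓ k (suc m) ⟩
      1ℚ + ι k * L               ≡⟨ identity ⟨
      L * D + two * ι t          ∎))
    where
    open ≤-Reasoning
    L : ℚ
    L = ι (suc m)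

  below-one : ∀ m t k D → ι (suc m) * D + two * ι t ≡ 1ℚ + ι k * ι (suc m) →
              1 Nat.+ k Nat.* suc m Nat.< 2 Nat.* t Nat.+ suc m → D <ℚ 1ℚ
  below-one m t k D identity 1+kℓ<2t+ℓ =
    *-cancelˡ-<-nonNeg L (+-cancelʳ-< (L * D) (L * 1ℚ) (two * ι t) (begin-strict
      L * D + two * ι t          ≡⟨ identity ⟩
      1ℚ + ι k * L               ≡⟨ ι-1+kℓ k (suc m) ⟨
      ι (1 Nat.+ k Nat.* suc m)  <⟨ ι-mono-< 1+kℓ<2t+ℓ ⟩
      ι (2 Nat.* t Nat.+ suc m)  ≡⟨ ι-2t+ℓ t (suc m) ⟩
      two * ι t + L              ≡⟨ L*1+2t L (ι t) ⟨
      L * 1ℚ + two * ι t         ∎))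
    where
    open ≤-Reasoning
    L : ℚ
    L = ι (suc m)

open import Data.Nat using (_*_; _+_; _<_)
open import Data.List using ([]; _∷_)
import Data.List.Relation.Unary.All as All
open import Data.Product using (_,_)
open import Relation.Binary.PropositionalEquality using (sym; subst)
open import Function using (_∘_)
open Flips using (shared; hamming-zero; shared-member; shared≤hamming; shared≤length; shared-outsider)
open Bounds using (far-enough; close-enough)
open Centroid using (centroid-identity; below-one; at-least-one)

lemma4 : (n : ℕ) (c : Point n) (A : List (Point n)) →
         Unique A →
         All (λ x → hamming c x ≡ 1) A →
         3 ≤ length A →
         ((a : Point n) → a ∈ A → dist² (centroid A) (embed a) <ℚ 1ℚ)
         × ((a : Point n) → a ∉ A → a ≢ c → 1ℚ ≤ℚ dist² (centroid A) (embed a))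
lemma4 n c []         _  _  ()
lemma4 n c A@(x ∷ xs) uA hA 3≤ℓ = inside , outside
  where
  ℓ : ℕ
  ℓ = length A

  inside : (a : Point n) → a ∈ A → dist² (centroid A) (embed a) <ℚ 1ℚ
  inside a a∈A = below-one (length xs) t (hamming c a) _ (centroid-identity c x xs uA hA a)
    (subst (λ k → 1 + k * ℓ < 2 * t + ℓ) (sym ha) (close-enough ℓ t (subst (_≤ t) ha (shared-member c a∈A))))
    where
    t : ℕ
    t = shared c A a
    ha : hamming c a ≡ 1
    ha = All.lookup hA a∈A

  outside : (a : Point n) → a ∉ A → a ≢ c → 1ℚ ≤ℚ dist² (centroid A) (embed a)
  outside a a∉A a≢c = at-least-one (length xs) (shared c A a) (hamming c a) _ (centroid-identity c x xs uA hA a)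
    (far-enough ℓ (hamming c a) (shared c A a) 3≤ℓ (a≢c ∘ hamming-zero c a)
      (shared≤hamming c A a uA hA) (shared≤length c A a hA) (λ ha → shared-outsider c A a hA ha a∉A))
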